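{- Let $\mathcal{B}$ be a lax contravariant lens over a reflexive graph $\mathcal{A}$. If each $\mathcal{B}(x)$ is univalent, then the display $\mathsf{disp}^-_{\mathcal{A}}\mathcal{B}$ is a univalent displayed reflexive graph.
   Context: Intensional Martin-Löf type theory with $\Pi,\Sigma$, identity types. A reflexive graph $\mathcal{G}$: vertex type $|\mathcal{G}|$, edge types $x\approx_{\mathcal{G}}y$, $\mathsf{rx}_{\mathcal{G}}(x):x\approx_{\mathcal{G}}x$; univalent if each fan $\sum_{y}x\approx_{\mathcal{G}}y$ is a proposition (equivalently, each co-fan $\sum_y y\approx_{\mathcal{G}}x$ is a proposition). A displayed reflexive graph $\mathcal{D}$ over $\mathcal{A}$: types $|\mathcal{D}|(x)$, types $u\approx^{\mathcal{D}}_pv$ for $p:x\approx_{\mathcal{A}}y$, $u:|\mathcal{D}|(x)$, $v:|\mathcal{D}|(y)$, and $\mathsf{rx}^{\mathcal{D}}_x(u):u\approx^{\mathcal{D}}_{\mathsf{rx}_{\mathcal{A}}(x)}u$; its component $\mathcal{D}(x)$ has vertices $|\mathcal{D}|(x)$, edges $u\approx^{\mathcal{D}}_{\mathsf{rx}_{\mathcal{A}}(x)}v$, reflexivity $\mathsf{rx}^{\mathcal{D}}_x$; $\mathcal{D}$ is univalent if every component is univalent. A lax contravariant lens over $\mathcal{A}$: family of reflexive graphs $\mathcal{B}(x)$, $\mathsf{pull}_p:|\mathcal{B}(y)|\to|\mathcal{B}(x)|$ for $p:x\approx_{\mathcal{A}}y$, and $\mathsf{pullRx}_x(u):u\approx_{\mathcal{B}(x)}\mathsf{pull}_{\mathsf{rx}_{\mathcal{A}}(x)}u$.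 Its display $\mathsf{disp}^-_{\mathcal{A}}\mathcal{B}$ has vertices $|\mathcal{B}(x)|$, edges $u\approx_pv:=u\approx_{\mathcal{B}(x)}\mathsf{pull}_pv$, and reflexivity $\mathsf{pullRx}_x(u)$. -}

{-# OPTIONS --without-K #-}
module Defs where

open import Level using (Level; _⊔_; suc)
open import Data.Product using (Σ; Σ-syntax; _,_)
open import Relation.Binary.PropositionalEquality using (_≡_)

isProp : ∀ {ℓ} → Set ℓ → Set ℓ
isProp A = (a b : A) → a ≡ b

record RGraph (ℓv ℓe : Level) : Set (suc (ℓv ⊔ ℓe)) where
  field
    ∣_∣ : Set ℓv
    _≈_ : ∣_∣ → ∣_∣ → Set ℓe
    rx  : (x : ∣_∣) → x ≈ x
open RGraph public

isUnivalent : ∀ {ℓv ℓe} → RGraph ℓv ℓe → Set (ℓv ⊔ ℓe)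
isUnivalent G = (x : ∣ G ∣) → isProp (Σ[ y ∈ ∣ G ∣ ] (_≈_ G x y))

record DispRGraph {ℓv ℓe} (A : RGraph ℓv ℓe) (ℓv' ℓe' : Level)
       : Set (ℓv ⊔ ℓe ⊔ suc (ℓv' ⊔ ℓe')) where
  field
    ∣_∣ᴰ : ∣ A ∣ → Set ℓv'
    edgeᴰ : {x y : ∣ A ∣} → _≈_ A x y → ∣_∣ᴰ x → ∣_∣ᴰ y → Set ℓe'
    rxᴰ : (x : ∣ A ∣) (u : ∣_∣ᴰ x) → edgeᴰ (rx A x) u u
open DispRGraph public

component : ∀ {ℓv ℓe ℓv' ℓe'} {A : RGraph ℓv ℓe}
  → DispRGraph A ℓv' ℓe' → ∣ A ∣ → RGraph ℓv' ℓe'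
component {A = A} D x = record
  { ∣_∣ = ∣ D ∣ᴰ x
  ; _≈_ = edgeᴰ D (rx A x)
  ; rx  = rxᴰ D x
  }

isUnivalentᴰ : ∀ {ℓv ℓe ℓv' ℓe'} {A : RGraph ℓv ℓe}
  → DispRGraph A ℓv' ℓe' → Set (ℓv ⊔ ℓv' ⊔ ℓe')
isUnivalentᴰ {A = A} D = (x : ∣ A ∣) → isUnivalent (component D x)

record LaxContraLens {ℓv ℓe} (A : RGraph ℓv ℓe) (ℓv' ℓe' : Level)
       : Set (ℓv ⊔ ℓe ⊔ suc (ℓv' ⊔ ℓe')) where
  field
    fam    : ∣ A ∣ → RGraph ℓv' ℓe'
    pull   : {x y : ∣ A ∣} → _≈_ A x y → ∣ fam y ∣ → ∣ fam x ∣
    pullRx : (x : ∣ A ∣) (u : ∣ fam x ∣) → _≈_ (fam x) u (pull (rx A x) u)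
open LaxContraLens public

disp⁻ : ∀ {ℓv ℓe ℓv' ℓe'} (A : RGraph ℓv ℓe)
  → LaxContraLens A ℓv' ℓe' → DispRGraph A ℓv' ℓe'
disp⁻ A B = record
  { ∣_∣ᴰ  = λ x → ∣ fam B x ∣
  ; edgeᴰ = λ {x} {y} p u v → _≈_ (fam B x) u (pull B p v)
  ; rxᴰ   = pullRx B
  }

{-# OPTIONS --without-K #-}
-- Univalence of 𝓑(x) forces pull along a reflexivity edge to be pointwise equal to the
-- identity, since v ≈ v and v ≈ pull v give two points of the same fan. Hence the fan of
-- the component at x, Σ v, u ≈ pull v, is a retract of the fan Σ v, u ≈ v of 𝓑(x),
-- and retracts of propositions are propositions.
module Submission where

open import Defs
open import Data.Product using (Σ; Σ-syntax; _,_; proj₁)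
open import Relation.Binary.PropositionalEquality
  using (_≡_; sym; trans; cong; subst; subst-subst-sym)

isProp-retract : ∀ {a b} {X : Set a} {Y : Set b} (f : X → Y) (g : Y → X)
  → (∀ x → g (f x) ≡ x) → isProp Y → isProp X
isProp-retract f g g∘f≡id isPropY x x′ =
  trans (sym (g∘f≡id x)) (trans (cong g (isPropY (f x) (f x′))) (g∘f≡id x′))

Σ-reindex-retract : ∀ {a b} {V : Set a} (P : V → Set b) (h : V → V)
  → (∀ v → v ≡ h v) → isProp (Σ[ v ∈ V ] P v) → isProp (Σ[ v ∈ V ] P (h v))
Σ-reindex-retract P h v≡hv = isProp-retract to from from∘to≡id
  where
    to : Σ[ v ∈ _ ] P (h v) → Σ[ v ∈ _ ] P v
    to (v , e) = v , subst P (sym (v≡hv v)) e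
    from : Σ[ v ∈ _ ] P v → Σ[ v ∈ _ ] P (h v)
    from (v , e) = v , subst P (v≡hv v) e
    from∘to≡id : ∀ z → from (to z) ≡ z
    from∘to≡id (v , e) = cong (v ,_) (subst-subst-sym {P = P} (v≡hv v))

univalent-≈-endo-≡id : ∀ {ℓv ℓe} (G : RGraph ℓv ℓe) → isUnivalent G
  → (h : ∣ G ∣ → ∣ G ∣) → (∀ v → _≈_ G v (h v)) → ∀ v → v ≡ h v
univalent-≈-endo-≡id G univ h v≈hv v =
  cong proj₁ (univ v (v , rx G v) (h v , v≈hv v))

mainTheorem5 : ∀ {ℓv ℓe ℓv' ℓe'} (A : RGraph ℓv ℓe) (B : LaxContraLens A ℓv' ℓe')
    → ((x : ∣ A ∣) → isUnivalent (fam B x))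
    → isUnivalentᴰ (disp⁻ A B)
mainTheorem5 A B univ x u =
  Σ-reindex-retract (_≈_ (fam B x) u) (pull B (rx A x))
    (univalent-≈-endo-≡id (fam B x) (univ x) (pull B (rx A x)) (pullRx B x))
    (univ x u)
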